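{- If $f,g,r,s\in \mathbb{I}(\mathcal{P},R)$ and $f(b,b)g(a,a)=1$ for all $a,b\in \mathcal{P}$, then $$(f\Diamond g)\triangleright (r\Diamond s) =(f*r)\Diamond (s*g).$$
   Context: Let $R$ be a commutative ring and $\mathcal{P}$ a locally finite poset. Write $\mathcal{F}l^k(\mathcal{P})=\{(x_1,\ldots,x_k)\in\mathcal{P}^k : x_1\leq\cdots\leq x_k\}$. The incidence algebra $\mathbb{I}(\mathcal{P},R)$ is the set of functions $\mathcal{F}l^2(\mathcal{P})\to R$ with convolution $(f*g)(x,y)=\sum_{x\leq a\leq y} f(x,a)g(a,y)$. The set $\mathbb{J}(\mathcal{P},R)$ consists of functions $\mathcal{F}l^3(\mathcal{P})\to R$, with the product $\triangleright$ defined by $$(F\triangleright G)(x,y,z)=\sum_{x\leq a\leq y\leq b\leq z} F(x,a,a)\,G(a,y,b)\,F(b,b,z).$$ For $f,g\in\mathbb{I}(\mathcal{P},R)$, the function $f\Diamond g\in\mathbb{J}(\mathcal{P},R)$ is defined by $(f\Diamond g)(x,y,z)=f(x,y)g(y,z)$. -}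

module Defs where

open import Level using (Level; _⊔_) renaming (suc to lsuc)
open import Data.List using (List; foldr; map)
open import Data.List.Relation.Unary.Unique.Propositional using (Unique)
open import Data.List.Membership.Propositional using (_∈_)
open import Data.Product using (_×_)
open import Function.Bundles using (_⇔_)
open import Relation.Binary.Core using (Rel)
open import Relation.Binary.Structures using (IsPartialOrder)
open import Relation.Binary.PropositionalEquality using (_≡_)
open import Algebra.Bundles using (CommutativeRing)

record LocallyFinitePoset (c ℓ : Level) : Set (lsuc (c ⊔ ℓ)) where
  field
    Carrier        : Set c
    _≤_            : Rel Carrier ℓ
    isPartialOrder : IsPartialOrder _≡_ _≤_
    interval       : Carrier → Carrier → List Carrier
    interval-unique : ∀ x y → Unique (interval x y)
    interval-∈     : ∀ x y a → (a ∈ interval x y) ⇔ ((x ≤ a) × (a ≤ y))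

module _ {c ℓ r ℓr : Level} (P : LocallyFinitePoset c ℓ) (R : CommutativeRing r ℓr) where
  open LocallyFinitePoset P using (Carrier; interval)
  open CommutativeRing R renaming (Carrier to RC)

  ΣI : Carrier → Carrier → (Carrier → RC) → RC
  ΣI x y h = foldr _+_ 0# (map h (interval x y))

  -- 𝕀(P,R): functions on Fl²(P); represented as functions P → P → R,
  -- of which only the values on pairs x ≤ y are ever used.
  𝕀 : Set (c ⊔ r)
  𝕀 = Carrier → Carrier → RC

  -- 𝕁(P,R): functions on Fl³(P), represented likewise.
  𝕁 : Set (c ⊔ r)
  𝕁 = Carrier → Carrier → Carrier → RC

  _⊛_ : 𝕀 → 𝕀 → 𝕀
  (f ⊛ g) x y = ΣI x y (λ a → f x a * g a y)

  _◇_ : 𝕀 → 𝕀 → 𝕁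
  (f ◇ g) x y z = f x y * g y z

  _▷_ : 𝕁 → 𝕁 → 𝕁
  (F ▷ G) x y z = ΣI x y (λ a → ΣI y z (λ b → F x a a * G a y b * F b b z))

-- In the summand f(x,a) g(a,a) · s(a,y) t(y,b) · f(b,b) g(b,z) of the left-hand side, the
-- diagonal factors g(a,a) and f(b,b) multiply to 1. What remains is a product of a term
-- depending only on a and a term depending only on b, so the double sum over a ∈ [x,y],
-- b ∈ [y,z] splits as (f * s)(x,y) · (t * g)(y,z).
module Submission where

open import Defs
open import Level using (Level)
open import Algebra.Bundles using (CommutativeRing)
open import Data.List using (List; []; _∷_; foldr; map)
open import Data.Fin using (zero; suc)
open import Data.Vec using ([]; _∷_)
import Algebra.Solver.CommutativeMonoid as CommutativeMonoidSolver
import Relation.Binary.Reasoning.Setoid as SetoidReasoning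

module FiniteSums {r ℓr} (R : CommutativeRing r ℓr) where
  open CommutativeRing R

  sumOver : ∀ {a} {A : Set a} → List A → (A → Carrier) → Carrier
  sumOver l h = foldr _+_ 0# (map h l)

  sumOver-cong : ∀ {a} {A : Set a} (l : List A) {h k : A → Carrier} →
                 (∀ x → h x ≈ k x) → sumOver l h ≈ sumOver l k
  sumOver-cong []      h≈k = refl
  sumOver-cong (x ∷ l) h≈k = +-cong (h≈k x) (sumOver-cong l h≈k)

  *-distribˡ-sumOver : ∀ {a} {A : Set a} (d : Carrier) (l : List A) (h : A → Carrier) →
                       d * sumOver l h ≈ sumOver l (λ x → d * h x)
  *-distribˡ-sumOver d []      h = zeroʳ d
  *-distribˡ-sumOver d (x ∷ l) h =
    trans (distribˡ d (h x) (sumOver l h)) (+-cong refl (*-distribˡ-sumOver d l h))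

  *-distribʳ-sumOver : ∀ {a} {A : Set a} (d : Carrier) (l : List A) (h : A → Carrier) →
                       sumOver l h * d ≈ sumOver l (λ x → h x * d)
  *-distribʳ-sumOver d []      h = zeroˡ d
  *-distribʳ-sumOver d (x ∷ l) h =
    trans (distribʳ d (h x) (sumOver l h)) (+-cong refl (*-distribʳ-sumOver d l h))

  sumOver-*-sumOver : ∀ {a b} {A : Set a} {B : Set b}
                      (l : List A) (m : List B) (h : A → Carrier) (k : B → Carrier) →
                      sumOver l h * sumOver m k ≈ sumOver l (λ x → sumOver m (λ y → h x * k y))
  sumOver-*-sumOver l m h k = begin
    sumOver l h * sumOver m k                       ≈⟨ *-distribʳ-sumOver (sumOver m k) l h ⟩
    sumOver l (λ x → h x * sumOver m k)             ≈⟨ sumOver-cong l (λ x → *-distribˡ-sumOver (h x) m k) ⟩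
    sumOver l (λ x → sumOver m (λ y → h x * k y))   ∎
    where open SetoidReasoning setoid

module _ {r ℓr} (R : CommutativeRing r ℓr) where
  open CommutativeRing R hiding (zero)

  *-cancel-inner : ∀ {u v} (a c d h : Carrier) → u * v ≈ 1# →
                   (a * v) * (c * d) * (u * h) ≈ (a * c) * (d * h)
  *-cancel-inner {u} {v} a c d h uv≈1 = begin
    (a * v) * (c * d) * (u * h)   ≈⟨ rearrange ⟩
    (a * c) * (d * h) * (u * v)   ≈⟨ *-congˡ uv≈1 ⟩
    (a * c) * (d * h) * 1#        ≈⟨ *-identityʳ _ ⟩
    (a * c) * (d * h)             ∎
    where
    open SetoidReasoning setoid
    open CommutativeMonoidSolver *-commutativeMonoid
    rearrange : (a * v) * (c * d) * (u * h) ≈ (a * c) * (d * h) * (u * v)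
    rearrange = prove 6 (((A ⊕ V) ⊕ (C ⊕ D)) ⊕ (U ⊕ H)) (((A ⊕ C) ⊕ (D ⊕ H)) ⊕ (U ⊕ V))
                        (a ∷ v ∷ c ∷ d ∷ u ∷ h ∷ [])
      where
      A = var zero
      V = var (suc zero)
      C = var (suc (suc zero))
      D = var (suc (suc (suc zero)))
      U = var (suc (suc (suc (suc zero))))
      H = var (suc (suc (suc (suc (suc zero)))))

proposition4p1 : ∀ {c ℓ r ℓr : Level} (P : LocallyFinitePoset c ℓ) (R : CommutativeRing r ℓr)
    → (f g s t : 𝕀 P R)
    → (∀ a b → CommutativeRing._≈_ R (CommutativeRing._*_ R (f b b) (g a a)) (CommutativeRing.1# R))
    → ∀ x y z → LocallyFinitePoset._≤_ P x y → LocallyFinitePoset._≤_ P y z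
    → CommutativeRing._≈_ R (_▷_ P R (_◇_ P R f g) (_◇_ P R s t) x y z) (_◇_ P R (_⊛_ P R f s) (_⊛_ P R t g) x y z)
proposition4p1 P R f g s t fg≈1 x y z _ _ = begin
    sumOver [x,y] (λ a → sumOver [y,z] (λ b → (f x a * g a a) * (s a y * t y b) * (f b b * g b z)))
      ≈⟨ sumOver-cong [x,y] (λ a → sumOver-cong [y,z] (λ b →
           *-cancel-inner R (f x a) (s a y) (t y b) (g b z) (fg≈1 a b))) ⟩
    sumOver [x,y] (λ a → sumOver [y,z] (λ b → (f x a * s a y) * (t y b * g b z)))
      ≈⟨ sym (sumOver-*-sumOver [x,y] [y,z] (λ a → f x a * s a y) (λ b → t y b * g b z)) ⟩
    sumOver [x,y] (λ a → f x a * s a y) * sumOver [y,z] (λ b → t y b * g b z)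
      ∎
  where
  open CommutativeRing R
  open SetoidReasoning setoid
  open FiniteSums R
  open LocallyFinitePoset P using (interval)
  [x,y] = interval x y
  [y,z] = interval y z
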